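{- For integers $n\ge 1$ and $r\ge 1$, the number of Dyck $(n+r)$-paths with exactly $r$ peaks and exactly $s$ peak plateaus equals $N(n,s)\binom{2n+r-s}{r-s}$ for each $1\le s\le r$. Consequently, \[ N(n+r,r)=\sum_{s=1}^{r}N(n,s)\binom{2n+r-s}{r-s}. \]
   Context: A Dyck $m$-path is a lattice path consisting of $m$ upsteps $U=(1,1)$ and $m$ downsteps $D=(1,-1)$ that never goes below the horizontal line through its start and end points. A peak is an occurrence of $UD$ (consecutive steps). A peak plateau is a maximal run of consecutive peaks that is immediately preceded by an upstep and immediately followed by a downstep, i.e., a subpath of the form $U(UD)^{i}D$ with $i\ge 1$. $N(m,k):=\frac{1}{m}\binom{m}{k}\binom{m}{k-1}$ denotes the Narayana number, which counts Dyck $m$-paths with exactly $k$ peaks. -}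

module Defs where

open import Data.Nat using (ℕ; zero; suc; _+_; _*_; _∸_; _/_; _≤_)
open import Data.Nat.Combinatorics using (_C_)
open import Data.List using (List; []; _∷_; length; filterᵇ; concatMap)
open import Data.Bool using (Bool; true; false; if_then_else_; _∧_)
open import Relation.Nullary using (Dec; yes; no)
open import Relation.Nullary.Decidable using (⌊_⌋; _×-dec_)
open import Relation.Binary.PropositionalEquality using (_≡_)
import Data.Nat as ℕ
open import Data.Product using (_×_)

-- Steps of a lattice path: U = (1,1), D = (1,-1)
data Step : Set where
  U D : Step

allWords : ℕ → List (List Step)
allWords zero = [] ∷ []
allWords (suc ℓ) = concatMap (λ w → (U ∷ w) ∷ (D ∷ w) ∷ []) (allWords ℓ)

endsAtZeroFrom : ℕ → List Step → Bool
endsAtZeroFrom zero [] = true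
endsAtZeroFrom (suc _) [] = false
endsAtZeroFrom h (U ∷ w) = endsAtZeroFrom (suc h) w
endsAtZeroFrom zero (D ∷ w) = false
endsAtZeroFrom (suc h) (D ∷ w) = endsAtZeroFrom h w

countU : List Step → ℕ
countU [] = 0
countU (U ∷ w) = suc (countU w)
countU (D ∷ w) = countU w

isDyck : ℕ → List Step → Bool
isDyck m w = endsAtZeroFrom 0 w ∧ (⌊ length w ℕ.≟ (m + m) ⌋ ∧ ⌊ countU w ℕ.≟ m ⌋)

peaks : List Step → ℕ
peaks [] = 0
peaks (U ∷ D ∷ w) = suc (peaks (D ∷ w))
peaks (_ ∷ w) = peaks w

startsPeaksThenD : List Step → Bool
startsPeaksThenD (U ∷ D ∷ D ∷ _) = true
startsPeaksThenD (U ∷ D ∷ w) = startsPeaksThenD w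
startsPeaksThenD _ = false

-- number of peak plateaus: occurrences of a subpath U (UD)^i D with i ≥ 1
-- (any such occurrence is automatically a maximal run of peaks)
plateaus : List Step → ℕ
plateaus [] = 0
plateaus (U ∷ w) = (if startsPeaksThenD w then 1 else 0) + plateaus w
plateaus (D ∷ w) = plateaus w

countDyck : (m r s : ℕ) → ℕ
countDyck m r s = length (filterᵇ (λ w → isDyck m w ∧ (⌊ peaks w ℕ.≟ r ⌋ ∧ ⌊ plateaus w ℕ.≟ s ⌋)) (allWords (m + m)))

countDyckPeaks : (m k : ℕ) → ℕ
countDyckPeaks m k = length (filterᵇ (λ w → isDyck m w ∧ ⌊ peaks w ℕ.≟ k ⌋) (allWords (m + m)))

-- Narayana number N(m,k) = (1/m) (m choose k) (m choose k-1)  (for m ≥ 1 the division is exact)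
-- (N(0,k) is never used; we set it to 0)
narayana : (m k : ℕ) → ℕ
narayana zero k = 0
narayana m@(suc _) k = ((m C k) * (m C (k ∸ 1))) / m

sumFrom1 : ℕ → (ℕ → ℕ) → ℕ
sumFrom1 zero f = 0
sumFrom1 (suc r) f = sumFrom1 r f + f (suc r)

module Submission where

-- Let  reduce w  delete every occurrence of UD from a word w.  Then
--   * the peak plateaus of w are exactly the peaks of  reduce w  (plateaus-reduce);
--   * w is a Dyck (n+r)-path with r peaks iff  reduce w  is a Dyck n-path
--     and w has r peaks (excursion-reduce, countU-reduce);
--   * a word v of length M with p peaks has exactly  C(M+r-p, r-p)  preimages
--     of length M+2r with r peaks, and none if p > r (fibreSum-formula).
-- Summing over the fibres of  reduce  thus turns both claims of mainTheorem1
-- into statements about Dyck n-paths counted by their number of peaks, which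
-- are given by the Narayana formula (paths-narayana).  The latter is proved
-- for paths starting at an arbitrary height by a ballot-type identity
-- (paths-ballot) and then specialised to height 0.

open import Defs
open import Data.Nat using (ℕ; zero; suc; _+_; _*_; _∸_; _≤_; _<_; s≤s; z≤n; _/_; _≡ᵇ_)
import Data.Nat as ℕ
open import Data.Nat.Properties
open import Data.Nat.DivMod using (m*n/n≡m)
open import Data.Nat.Combinatorics using (_C_; nCk+nC[k+1]≡[n+1]C[k+1])
open import Data.Nat.Tactic.RingSolver using (solve-∀)
open import Data.List using (List; []; _∷_; length; filterᵇ; concatMap)
open import Data.Bool using (Bool; true; false; if_then_else_; _∧_; T)
open import Data.Bool.Properties using (∧-assoc; ∧-zeroʳ; ∧-identityʳ)
open import Data.Empty using (⊥-elim)
open import Data.Product using (_×_; _,_)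
open import Relation.Nullary.Decidable using (⌊_⌋; isYes≗does)
open import Relation.Binary.PropositionalEquality

infixr 5 _∙_
_∙_ : ∀ {A : Set} {x y z : A} → x ≡ y → y ≡ z → x ≡ z
_∙_ = trans

ind : Bool → ℕ
ind b = if b then 1 else 0

ind-∧ : ∀ a b → ind (a ∧ b) ≡ ind a * ind b
ind-∧ true b = sym (+-identityʳ _)
ind-∧ false b = refl

Σw : ℕ → (List Step → ℕ) → ℕ
Σw zero f = f []
Σw (suc ℓ) f = Σw ℓ (λ w → f (U ∷ w)) + Σw ℓ (λ w → f (D ∷ w))

Σw-cong : ∀ ℓ {f g : List Step → ℕ} → (∀ w → length w ≡ ℓ → f w ≡ g w) → Σw ℓ f ≡ Σw ℓ g
Σw-cong zero h = h [] refl
Σw-cong (suc ℓ) h =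
  cong₂ _+_ (Σw-cong ℓ (λ w e → h (U ∷ w) (cong suc e))) (Σw-cong ℓ (λ w e → h (D ∷ w) (cong suc e)))

Σw-zero : ∀ ℓ {f : List Step → ℕ} → (∀ w → length w ≡ ℓ → f w ≡ 0) → Σw ℓ f ≡ 0
Σw-zero zero h = h [] refl
Σw-zero (suc ℓ) h =
  cong₂ _+_ (Σw-zero ℓ (λ w e → h (U ∷ w) (cong suc e))) (Σw-zero ℓ (λ w e → h (D ∷ w) (cong suc e)))

Σw-+ : ∀ ℓ (f g : List Step → ℕ) → Σw ℓ (λ w → f w + g w) ≡ Σw ℓ f + Σw ℓ g
Σw-+ zero f g = refl
Σw-+ (suc ℓ) f g =
  cong₂ _+_ (Σw-+ ℓ (λ w → f (U ∷ w)) (λ w → g (U ∷ w))) (Σw-+ ℓ (λ w → f (D ∷ w)) (λ w → g (D ∷ w)))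
  ∙ interchange (Σw ℓ (λ w → f (U ∷ w))) (Σw ℓ (λ w → g (U ∷ w))) (Σw ℓ (λ w → f (D ∷ w))) (Σw ℓ (λ w → g (D ∷ w)))
  where
  interchange : ∀ a b c d → (a + b) + (c + d) ≡ (a + c) + (b + d)
  interchange = solve-∀

Σw-* : ∀ ℓ k (f : List Step → ℕ) → Σw ℓ (λ w → k * f w) ≡ k * Σw ℓ f
Σw-* zero k f = refl
Σw-* (suc ℓ) k f =
  cong₂ _+_ (Σw-* ℓ k (λ w → f (U ∷ w))) (Σw-* ℓ k (λ w → f (D ∷ w))) ∙ sym (*-distribˡ-+ k _ _)

Σw-distribʳ : ∀ ℓ (f g h : List Step → ℕ) →
  Σw ℓ (λ v → (f v + g v) * h v) ≡ Σw ℓ (λ v → f v * h v) + Σw ℓ (λ v → g v * h v)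
Σw-distribʳ ℓ f g h = Σw-cong ℓ (λ v _ → *-distribʳ-+ (h v) (f v) (g v)) ∙ Σw-+ ℓ _ _

length-filterᵇ-∷ : ∀ (p : List Step → Bool) x xs →
  length (filterᵇ p (x ∷ xs)) ≡ ind (p x) + length (filterᵇ p xs)
length-filterᵇ-∷ p x xs with p x
... | true = refl
... | false = refl

length-filterᵇ-extend : ∀ (p : List Step → Bool) xs →
  length (filterᵇ p (concatMap (λ w → (U ∷ w) ∷ (D ∷ w) ∷ []) xs)) ≡
  length (filterᵇ (λ w → p (U ∷ w)) xs) + length (filterᵇ (λ w → p (D ∷ w)) xs)
length-filterᵇ-extend p [] = refl
length-filterᵇ-extend p (x ∷ xs) =
  length-filterᵇ-∷ p (U ∷ x) _
  ∙ cong (ind (p (U ∷ x)) +_) (length-filterᵇ-∷ p (D ∷ x) _ ∙ cong (ind (p (D ∷ x)) +_) (length-filterᵇ-extend p xs))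
  ∙ interchange (ind (p (U ∷ x))) (ind (p (D ∷ x))) _ _
  ∙ sym (cong₂ _+_ (length-filterᵇ-∷ (λ w → p (U ∷ w)) x xs) (length-filterᵇ-∷ (λ w → p (D ∷ w)) x xs))
  where
  interchange : ∀ a b c d → a + (b + (c + d)) ≡ (a + c) + (b + d)
  interchange = solve-∀

count-allWords : ∀ ℓ (p : List Step → Bool) → length (filterᵇ p (allWords ℓ)) ≡ Σw ℓ (λ w → ind (p w))
count-allWords zero p with p []
... | true = refl
... | false = refl
count-allWords (suc ℓ) p =
  length-filterᵇ-extend p (allWords ℓ) ∙ cong₂ _+_ (count-allWords ℓ _) (count-allWords ℓ _)

-- Defs tests equality of counts with ⌊ _≟_ ⌋, which does not compute on
-- open terms; the proofs work with the boolean test _≡ᵇ_ instead.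
≟⇒≡ᵇ : ∀ m n → ⌊ m ℕ.≟ n ⌋ ≡ (m ≡ᵇ n)
≟⇒≡ᵇ m n = isYes≗does (m ℕ.≟ n)

≡ᵇ-refl : ∀ n → (n ≡ᵇ n) ≡ true
≡ᵇ-refl zero = refl
≡ᵇ-refl (suc n) = ≡ᵇ-refl n

≡ᵇ-sound : ∀ m n → (m ≡ᵇ n) ≡ true → m ≡ n
≡ᵇ-sound m n e = ≡ᵇ⇒≡ m n (subst T (sym e) _)

≡ᵇ-cancelʳ : ∀ a b r → ((a + r) ≡ᵇ (b + r)) ≡ (a ≡ᵇ b)
≡ᵇ-cancelʳ a b r = cong₂ _≡ᵇ_ (+-comm a r) (+-comm b r) ∙ cancelˡ r
  where
  cancelˡ : ∀ r → ((r + a) ≡ᵇ (r + b)) ≡ (a ≡ᵇ b)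
  cancelˡ zero = refl
  cancelˡ (suc r) = cancelˡ r

-- Binomial coefficients by Pascal's rule; unlike _C_ they compute on
-- symbolic arguments, which the inductive proofs below rely on.
bin : ℕ → ℕ → ℕ
bin n zero = 1
bin zero (suc k) = 0
bin (suc n) (suc k) = bin n k + bin n (suc k)

bin≡C : ∀ n k → bin n k ≡ n C k
bin≡C n zero = refl
bin≡C zero (suc k) = refl
bin≡C (suc n) (suc k) = cong₂ _+_ (bin≡C n k) (bin≡C n (suc k)) ∙ nCk+nC[k+1]≡[n+1]C[k+1] n k

bin-> : ∀ n k → n < k → bin n k ≡ 0
bin-> zero (suc k) lt = refl
bin-> (suc n) (suc k) (s≤s lt) = cong₂ _+_ (bin-> n k lt) (bin-> n (suc k) (m≤n⇒m≤1+n lt))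

bin-diag : ∀ n → bin n n ≡ 1
bin-diag zero = refl
bin-diag (suc n) = cong₂ _+_ (bin-diag n) (bin-> n (suc n) ≤-refl)

bin-absorb : ∀ n k → suc k * bin (suc n) (suc k) ≡ suc n * bin n k
bin-absorb zero zero = refl
bin-absorb zero (suc k) = *-zeroʳ (suc (suc k))
bin-absorb (suc n) zero = cong suc (bin-absorb n zero)
bin-absorb (suc n) (suc j) =
  expand j (bin n j) (bin n (suc j)) (bin n (suc (suc j)))
  ∙ cong₂ (λ u v → (bin n j + bin n (suc j)) + u + v) (bin-absorb n j) (bin-absorb n (suc j))
  ∙ collect n (bin n j) (bin n (suc j))
  where
  expand : ∀ j c₀ c₁ c₂ → suc (suc j) * ((c₀ + c₁) + (c₁ + c₂)) ≡ (c₀ + c₁) + suc j * (c₀ + c₁) + suc (suc j) * (c₁ + c₂)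
  expand = solve-∀
  collect : ∀ n c₀ c₁ → (c₀ + c₁) + suc n * c₀ + suc n * c₁ ≡ suc (suc n) * (c₀ + c₁)
  collect = solve-∀

bin-absorb₂ : ∀ a k → suc k * bin (suc a) (suc k) + k * bin (suc a) k ≡ suc a * bin (suc a) k
bin-absorb₂ a zero = +-identityʳ _ ∙ bin-absorb a zero
bin-absorb₂ a (suc j) =
  cong₂ _+_ (bin-absorb a (suc j)) (bin-absorb a j) ∙ sym (*-distribˡ-+ (suc a) (bin a (suc j)) (bin a j))
  ∙ cong (suc a *_) (+-comm (bin a (suc j)) (bin a j))

-- excursion h w: the walk w started at height h never goes below 0 and ends
-- at 0.  Same as endsAtZeroFrom, but splitting on the word first, so that it
-- computes on a word starting with U at an unknown height.
excursion : ℕ → List Step → Bool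
excursion h (U ∷ w) = excursion (suc h) w
excursion zero [] = true
excursion (suc h) [] = false
excursion zero (D ∷ w) = false
excursion (suc h) (D ∷ w) = excursion h w

excursion≡endsAtZeroFrom : ∀ h w → excursion h w ≡ endsAtZeroFrom h w
excursion≡endsAtZeroFrom zero [] = refl
excursion≡endsAtZeroFrom (suc h) [] = refl
excursion≡endsAtZeroFrom zero (U ∷ w) = excursion≡endsAtZeroFrom 1 w
excursion≡endsAtZeroFrom (suc h) (U ∷ w) = excursion≡endsAtZeroFrom (suc (suc h)) w
excursion≡endsAtZeroFrom zero (D ∷ w) = refl
excursion≡endsAtZeroFrom (suc h) (D ∷ w) = excursion≡endsAtZeroFrom h w

-- w is an excursion from height h with a upsteps; for h = 0 and a = n these
-- are the Dyck n-paths.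
excursionWith : ℕ → ℕ → List Step → Bool
excursionWith h a w = excursion h w ∧ (countU w ≡ᵇ a)

weight : ℕ → ℕ → ℕ → List Step → ℕ
weight h a k w = ind (excursionWith h a w ∧ (peaks w ≡ᵇ k))

paths : ℕ → ℕ → ℕ → ℕ → ℕ
paths ℓ h a k = Σw ℓ (weight h a k)

upPaths : ℕ → ℕ → ℕ → ℕ → ℕ
upPaths ℓ h a k = Σw ℓ (λ w → weight h a k (U ∷ w))

upPaths-noUps : ∀ ℓ h k → upPaths ℓ h 0 k ≡ 0
upPaths-noUps ℓ h k = Σw-zero ℓ (λ w _ → cong (λ b → ind (b ∧ (peaks (U ∷ w) ≡ᵇ k))) (∧-zeroʳ (excursion (suc h) w)))

upPaths-noPeaks : ∀ ℓ h a → upPaths ℓ h a 0 ≡ 0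
upPaths-noPeaks zero h a = refl
upPaths-noPeaks (suc ℓ) h zero = upPaths-noUps (suc ℓ) h 0
upPaths-noPeaks (suc ℓ) h (suc a) =
  cong₂ _+_ (upPaths-noPeaks ℓ (suc h) a)
            (Σw-zero ℓ (λ w _ → cong ind (∧-zeroʳ (excursionWith h a w))))

paths-noPeaks : ∀ ℓ h a → paths ℓ h (suc a) 0 ≡ 0
paths-noPeaks zero zero a = refl
paths-noPeaks zero (suc h) a = refl
paths-noPeaks (suc ℓ) zero a = cong₂ _+_ (upPaths-noPeaks ℓ zero (suc a)) (Σw-zero ℓ (λ w _ → refl))
paths-noPeaks (suc ℓ) (suc h) a = cong₂ _+_ (upPaths-noPeaks ℓ (suc h) (suc a)) (paths-noPeaks ℓ h a)

-- From height 0 the first step must be an upstep.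
paths-fromGround : ∀ ℓ a k → paths (suc ℓ) 0 a k ≡ upPaths ℓ 0 a k
paths-fromGround ℓ a k = cong (upPaths ℓ 0 a k +_) (Σw-zero ℓ (λ w _ → refl)) ∙ +-identityʳ _

ballotCorrection : ℕ → ℕ → ℕ → ℕ
ballotCorrection A zero k = 0
ballotCorrection A (suc a) k = bin (suc A) k * bin a k

bin-noUps : ∀ m m' k → bin m k * bin 0 k ≡ bin m' k * bin 0 k
bin-noUps m m' zero = refl
bin-noUps m m' (suc k) = *-zeroʳ (bin m (suc k)) ∙ sym (*-zeroʳ (bin m' (suc k)))

-- Ballot identity: an excursion from height h with a upsteps has A = a + h
-- downsteps, and those with k peaks number  C(A,k) C(a,k) - C(A+1,k) C(a-1,k).
mutual
  paths-ballot : ∀ ℓ h a k A → a + h ≡ A → ℓ ≡ a + A →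
    paths ℓ h a k + ballotCorrection A a k ≡ bin A k * bin a k
  paths-ballot zero zero zero zero zero refl refl = refl
  paths-ballot zero zero zero (suc k) zero refl refl = refl
  paths-ballot zero zero zero k (suc A) eA ()
  paths-ballot zero (suc h) zero k zero () eℓ
  paths-ballot zero (suc h) zero k (suc A) eA ()
  paths-ballot zero h (suc a) k A eA ()
  paths-ballot (suc ℓ) zero zero k zero eA ()
  paths-ballot (suc ℓ) zero zero k (suc A) () eℓ
  paths-ballot (suc ℓ) (suc h) zero k .(suc h) refl eℓ =
    cong (λ x → x + paths ℓ h 0 k + 0) (upPaths-noUps ℓ (suc h) k)
    ∙ paths-ballot ℓ h zero k h refl (suc-injective eℓ)
    ∙ bin-noUps h (suc h) k
  paths-ballot (suc ℓ) h (suc a) zero A eA eℓ = cong (_+ 1) (paths-noPeaks (suc ℓ) h a)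
  paths-ballot (suc ℓ) zero (suc a) (suc k) zero () eℓ
  paths-ballot (suc ℓ) zero (suc a) (suc k) (suc A) eA eℓ with trans (sym (+-identityʳ a)) (suc-injective eA)
  ... | refl =
    cong (_+ ballotCorrection (suc a) (suc a) (suc k)) (paths-fromGround ℓ (suc a) (suc k))
    ∙ step (upPaths ℓ 0 (suc a) (suc k)) (bin a k) (bin a (suc k)) (bin (suc a) k)
        (upPaths-ballot ℓ zero a k a (+-identityʳ a) (suc-injective eℓ ∙ +-suc a a))
    where
    step : ∀ P x y z → P + z * y ≡ x * (x + y) → P + (z + (x + y)) * y ≡ (x + y) * (x + y)
    step P x y z H = regroup P x y z ∙ cong (_+ (x + y) * y) H ∙ square x y
      where
      regroup : ∀ P x y z → P + (z + (x + y)) * y ≡ (P + z * y) + (x + y) * y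
      regroup = solve-∀
      square : ∀ x y → x * (x + y) + (x + y) * y ≡ (x + y) * (x + y)
      square = solve-∀
  paths-ballot (suc ℓ) (suc h) (suc a) (suc k) zero () eℓ
  paths-ballot (suc ℓ) (suc h) (suc a) (suc k) (suc m) eA eℓ =
    step (upPaths ℓ (suc h) (suc a) (suc k)) (paths ℓ h (suc a) (suc k)) (bin (suc m) k) (bin m k) (bin m (suc k))
         (bin a (suc k)) (bin (suc a) (suc k))
      (upPaths-ballot ℓ (suc h) a k m (suc-injective eA) (suc-injective eℓ ∙ +-suc a m))
      (paths-ballot ℓ h (suc a) (suc k) m (sym (+-suc a h) ∙ suc-injective eA) (suc-injective eℓ ∙ +-suc a m))
    where
    step : ∀ P W B u v p q → P + B * p ≡ u * q → W + (u + v) * p ≡ v * q →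
           (P + W) + (B + (u + v)) * p ≡ (u + v) * q
    step P W B u v p q H₁ H₂ = regroup P W B u v p ∙ cong₂ _+_ H₁ H₂ ∙ sym (*-distribʳ-+ q u v)
      where
      regroup : ∀ P W B u v p → (P + W) + (B + (u + v)) * p ≡ (P + B * p) + (W + (u + v) * p)
      regroup = solve-∀

  upPaths-ballot : ∀ ℓ h a k A → a + h ≡ A → ℓ ≡ suc (a + A) →
    upPaths ℓ h (suc a) (suc k) + bin (suc A) k * bin a (suc k) ≡ bin A k * bin (suc a) (suc k)
  upPaths-ballot zero h a k A eA ()
  upPaths-ballot (suc ℓ) h zero k .h refl eℓ =
    cong (λ x → x + paths ℓ h 0 k + bin (suc h) k * 0) (upPaths-noUps ℓ (suc h) (suc k))
    ∙ cong (paths ℓ h 0 k +_) (*-zeroʳ (bin (suc h) k))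
    ∙ paths-ballot ℓ h zero k h refl (suc-injective eℓ)
    ∙ cong (bin h k *_) (sym (+-identityʳ (bin 0 k)))
  upPaths-ballot (suc ℓ) h (suc a) k A eA eℓ =
    step (upPaths ℓ (suc h) (suc a) (suc k)) (paths ℓ h (suc a) k) (bin (suc A) k) (bin A k)
         (bin a k) (bin a (suc k)) (bin (suc a) k)
      (upPaths-ballot ℓ (suc h) a k A (+-suc a h ∙ eA) (suc-injective eℓ))
      (paths-ballot ℓ h (suc a) k A eA (suc-injective eℓ))
    where
    step : ∀ P W Z X x y s → P + Z * y ≡ X * (x + y) → W + Z * x ≡ X * s →
           (P + W) + Z * (x + y) ≡ X * (s + (x + y))
    step P W Z X x y s H₁ H₂ = regroup P W Z x y ∙ cong₂ _+_ H₂ H₁ ∙ sym (*-distribˡ-+ X s (x + y))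
      where
      regroup : ∀ P W Z x y → (P + W) + Z * (x + y) ≡ (W + Z * x) + (P + Z * y)
      regroup = solve-∀

-- Solving for the count P of Dyck (a+1)-paths with k+1 peaks: from the
-- ballot identity  P + C(a+1,k) y = x (x+y)  (x = C(a,k), y = C(a,k+1)) and
-- the absorption identities one gets  (a+1) P = C(a+1,k+1) C(a+1,k).
narayana-identity : ∀ N k P x y B → P + B * y ≡ x * (x + y) → suc k * (x + y) ≡ N * x →
  suc k * (x + y) + k * B ≡ N * B → N * P ≡ (x + y) * B
narayana-identity N k P x y B H₁ H₂ H₃ = +-cancelʳ-≡ common (N * P) ((x + y) * B) chain
  where
  common : ℕ
  common = N * B * (x + y) + k * B * (x + y)
  s₁ : ∀ N k P x y B → N * P + (N * B * (x + y) + k * B * (x + y)) ≡ N * (P + B * y) + B * (N * x) + k * B * (x + y)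
  s₁ = solve-∀
  s₂ : ∀ N k x y B → N * (x * (x + y)) + B * (N * x) + k * B * (x + y) ≡ (x + y) * (N * x) + B * (N * x) + k * B * (x + y)
  s₂ = solve-∀
  s₃ : ∀ k x y B R → (x + y) * R + B * R + k * B * (x + y) ≡ (x + y) * (R + k * B) + B * R
  s₃ = solve-∀
  s₄ : ∀ N k x y B → (x + y) * (N * B) + B * (suc k * (x + y)) ≡ (x + y) * B + (N * B * (x + y) + k * B * (x + y))
  s₄ = solve-∀
  chain : N * P + common ≡ (x + y) * B + common
  chain = s₁ N k P x y B
    ∙ cong (λ z → N * z + B * (N * x) + k * B * (x + y)) H₁
    ∙ s₂ N k x y B
    ∙ cong (λ z → (x + y) * z + B * z + k * B * (x + y)) (sym H₂)
    ∙ s₃ k x y B (suc k * (x + y))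
    ∙ cong (λ z → (x + y) * z + B * (suc k * (x + y))) H₃
    ∙ s₄ N k x y B

paths-narayana : ∀ a k → paths (suc a + suc a) 0 (suc a) (suc k) ≡ narayana (suc a) (suc k)
paths-narayana a k = paths-fromGround (a + suc a) (suc a) (suc k) ∙ sym
  (cong₂ (λ u v → (u * v) / suc a) (sym (bin≡C (suc a) (suc k))) (sym (bin≡C (suc a) k))
   ∙ cong (_/ suc a) (sym scaled ∙ *-comm (suc a) P)
   ∙ m*n/n≡m P (suc a))
  where
  P = upPaths (a + suc a) 0 (suc a) (suc k)
  scaled : suc a * P ≡ bin (suc a) (suc k) * bin (suc a) k
  scaled = narayana-identity (suc a) k P (bin a k) (bin a (suc k)) (bin (suc a) k)
             (upPaths-ballot (a + suc a) 0 a k a (+-identityʳ a) (+-suc a a)) (bin-absorb a k) (bin-absorb₂ a k)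

-- The reduction map deletes every peak UD (once, not recursively).
reduce : List Step → List Step
reduce [] = []
reduce (U ∷ D ∷ w) = reduce w
reduce (x ∷ w) = x ∷ reduce w

-- Deleting UD does not change the heights of the remaining steps.
excursion-reduce : ∀ h w → excursion h (reduce w) ≡ excursion h w
excursion-reduce h [] = refl
excursion-reduce h (U ∷ []) = refl
excursion-reduce h (U ∷ D ∷ w) = excursion-reduce h w
excursion-reduce h (U ∷ U ∷ w) = excursion-reduce (suc h) (U ∷ w)
excursion-reduce zero (D ∷ w) = refl
excursion-reduce (suc h) (D ∷ w) = excursion-reduce h w

-- Each deleted peak removes one upstep.
countU-reduce : ∀ w → countU (reduce w) + peaks w ≡ countU w
countU-reduce [] = refl
countU-reduce (U ∷ []) = refl
countU-reduce (U ∷ D ∷ w) = +-suc (countU (reduce w)) (peaks w) ∙ cong suc (countU-reduce w)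
countU-reduce (U ∷ U ∷ w) = cong suc (countU-reduce (U ∷ w))
countU-reduce (D ∷ w) = countU-reduce w

startsWithD : List Step → Bool
startsWithD (D ∷ _) = true
startsWithD _ = false

peaks-U : ∀ x → peaks (U ∷ x) ≡ ind (startsWithD x) + peaks x
peaks-U [] = refl
peaks-U (U ∷ x) = refl
peaks-U (D ∷ x) = refl

-- U w begins with a plateau iff w starts with (UD)^i D, i.e. iff after
-- deleting the peaks U w starts with UD.
startsPeaksThenD-reduce : ∀ w → startsPeaksThenD (U ∷ w) ≡ startsWithD (reduce (U ∷ w))
startsPeaksThenD-reduce [] = refl
startsPeaksThenD-reduce (U ∷ w) = refl
startsPeaksThenD-reduce (D ∷ []) = refl
startsPeaksThenD-reduce (D ∷ D ∷ w) = refl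
startsPeaksThenD-reduce (D ∷ U ∷ w) = startsPeaksThenD-reduce w

plateaus-reduce : ∀ w → plateaus w ≡ peaks (reduce w)
plateaus-reduce [] = refl
plateaus-reduce (U ∷ []) = refl
plateaus-reduce (U ∷ D ∷ w) = plateaus-reduce w
plateaus-reduce (U ∷ U ∷ w) =
  cong₂ _+_ (cong ind (startsPeaksThenD-reduce w)) (plateaus-reduce (U ∷ w)) ∙ sym (peaks-U (reduce (U ∷ w)))
plateaus-reduce (D ∷ w) = plateaus-reduce w

twice : ℕ → ℕ
twice zero = 0
twice (suc r) = suc (suc (twice r))

twice≡+ : ∀ r → twice r ≡ r + r
twice≡+ zero = refl
twice≡+ (suc r) = cong suc (cong suc (twice≡+ r) ∙ sym (+-suc r r))

-- Every peak takes two steps.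
peaks-bound : ∀ w → twice (peaks w) ≤ length w
peaks-bound [] = z≤n
peaks-bound (U ∷ []) = z≤n
peaks-bound (U ∷ D ∷ w) = s≤s (s≤s (peaks-bound w))
peaks-bound (U ∷ U ∷ w) = m≤n⇒m≤1+n (peaks-bound (U ∷ w))
peaks-bound (D ∷ w) = m≤n⇒m≤1+n (peaks-bound w)

tooShort-peaks : ∀ L r w → L < twice r → length w ≡ L → (peaks w ≡ᵇ r) ≡ false
tooShort-peaks L r w lt e with peaks w ≡ᵇ r in eq
... | false = refl
... | true = ⊥-elim (<⇒≱ lt (subst₂ _≤_ (cong twice (≡ᵇ-sound _ _ eq)) e (peaks-bound w)))

-- fibre M r p: the number of words with r peaks reducing to a given word of
-- length M with p peaks;  C(M+r-p, r-p)  if p ≤ r (fibre-closed), else 0.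
fibre : ℕ → ℕ → ℕ → ℕ
fibre M r zero = bin (M + r) r
fibre M zero (suc p) = 0
fibre M (suc r) (suc p) = fibre M r p

fibre-closed : ∀ M r p → p ≤ r → fibre M r p ≡ bin (M + r ∸ p) (r ∸ p)
fibre-closed M r zero z≤n = refl
fibre-closed M (suc r) (suc p) (s≤s le) =
  fibre-closed M r p le ∙ cong (λ t → bin (t ∸ suc p) (r ∸ p)) (sym (+-suc M r))

fibre-noPeaks : ∀ M p → fibre (suc M) 0 p ≡ fibre M 0 p
fibre-noPeaks M zero = refl
fibre-noPeaks M (suc p) = refl

fibre-pascal : ∀ M r p → fibre (suc M) (suc r) p ≡ fibre M (suc r) p + fibre (suc M) r p
fibre-pascal M r zero =
  +-comm (bin (M + suc r) r) (bin (M + suc r) (suc r))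
  ∙ cong (λ t → bin (M + suc r) (suc r) + bin t r) (+-suc M r)
fibre-pascal M zero (suc p) = fibre-noPeaks M p ∙ sym (+-identityʳ _)
fibre-pascal M (suc r) (suc p) = fibre-pascal M r p

-- Number of r-peak preimages of v, and of those starting with U.
preimages : List Step → ℕ → ℕ
preimages v r = fibre (length v) r (peaks v)

upPreimages : List Step → ℕ → ℕ
upPreimages (U ∷ v) r = preimages (U ∷ v) r
upPreimages [] zero = 0
upPreimages [] (suc r) = fibre 0 r 0
upPreimages (D ∷ v) zero = 0
upPreimages (D ∷ v) (suc r) = fibre (suc (length v)) r (peaks v)

-- A preimage of D v either starts with U, or is D followed by a preimage of v.
preimages-D : ∀ v r → preimages (D ∷ v) r ≡ upPreimages (D ∷ v) r + preimages v r
preimages-D v zero = fibre-noPeaks (length v) (peaks v)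
preimages-D v (suc r) =
  fibre-pascal (length v) r (peaks v) ∙ +-comm (fibre (length v) (suc r) (peaks v)) (fibre (suc (length v)) r (peaks v))

-- A preimage of U v with r+1 peaks either starts with a deleted peak UD,
-- or is U followed by a word with r+1 peaks.
preimages-U : ∀ v r → preimages (U ∷ v) (suc r) ≡ upPreimages v (suc r) + preimages (U ∷ v) r
preimages-U [] r = cong (bin (suc r) r +_) (bin-diag (suc r) ∙ sym (bin-diag r)) ∙ +-comm (bin (suc r) r) (bin r r)
preimages-U (U ∷ v) r = fibre-pascal (suc (length v)) r (peaks (U ∷ v))
preimages-U (D ∷ v) zero = fibre-noPeaks (suc (length v)) (peaks v) ∙ sym (+-identityʳ _)
preimages-U (D ∷ v) (suc r) = fibre-pascal (suc (length v)) r (peaks v)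

upPreimages-noPeaks : ∀ v L → length v ≡ suc L → upPreimages (U ∷ v) 0 ≡ upPreimages v 0
upPreimages-noPeaks (U ∷ v) L e = fibre-noPeaks (suc (length v)) (peaks (U ∷ v))
upPreimages-noPeaks (D ∷ v) L e = refl

fibreSum : ℕ → ℕ → (List Step → ℕ) → ℕ
fibreSum L r ψ = Σw L (λ w → ind (peaks w ≡ᵇ r) * ψ (reduce w))

upFibreSum : ℕ → ℕ → (List Step → ℕ) → ℕ
upFibreSum L r ψ = Σw L (λ w → ind (peaks (U ∷ w) ≡ᵇ r) * ψ (reduce (U ∷ w)))

fibreSum-short : ∀ L r ψ → L < twice r → fibreSum L r ψ ≡ 0
fibreSum-short L r ψ lt = Σw-zero L (λ w e → cong (λ b → ind b * ψ (reduce w)) (tooShort-peaks L r w lt e))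

upFibreSum-short : ∀ L r ψ → suc L < twice r → upFibreSum L r ψ ≡ 0
upFibreSum-short L r ψ lt =
  Σw-zero L (λ w e → cong (λ b → ind b * ψ (reduce (U ∷ w))) (tooShort-peaks (suc L) r (U ∷ w) lt (cong suc e)))

mutual
  fibreSum-formula : ∀ L r (ψ : List Step → ℕ) M → L ≡ twice r + M →
    fibreSum L r ψ ≡ Σw M (λ v → preimages v r * ψ v)
  fibreSum-formula zero zero ψ zero refl = refl
  fibreSum-formula zero zero ψ (suc M) ()
  fibreSum-formula zero (suc r) ψ M ()
  fibreSum-formula (suc L) zero ψ zero ()
  fibreSum-formula (suc L) (suc r) ψ zero eq =
    cong₂ _+_ (upFibreSum-formula L (suc r) ψ zero eq)
              (fibreSum-short L (suc r) (λ v → ψ (D ∷ v)) (≤-reflexive (eq ∙ +-identityʳ _)))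
    ∙ +-identityʳ _ ∙ cong (_* ψ []) (bin-diag r ∙ sym (bin-diag (suc r)))
  fibreSum-formula (suc L) r ψ (suc M) eq =
    cong₂ _+_ (upFibreSum-formula L r ψ (suc M) eq)
              (fibreSum-formula L r (λ v → ψ (D ∷ v)) M (suc-injective (eq ∙ +-suc (twice r) M)))
    ∙ +-assoc startU startD rest
    ∙ cong (startU +_) (sym (Σw-distribʳ M (λ v → upPreimages (D ∷ v) r) (λ v → preimages v r) (λ v → ψ (D ∷ v)))
                        ∙ Σw-cong M (λ v _ → cong (_* ψ (D ∷ v)) (sym (preimages-D v r))))
    where
    startU startD rest : ℕ
    startU = Σw M (λ v → upPreimages (U ∷ v) r * ψ (U ∷ v))
    startD = Σw M (λ v → upPreimages (D ∷ v) r * ψ (D ∷ v))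
    rest = Σw M (λ v → preimages v r * ψ (D ∷ v))

  upFibreSum-formula : ∀ L r (ψ : List Step → ℕ) M → suc L ≡ twice r + M →
    upFibreSum L r ψ ≡ Σw M (λ v → upPreimages v r * ψ v)
  upFibreSum-formula zero zero ψ (suc zero) refl = sym (+-identityʳ _)
  upFibreSum-formula zero zero ψ zero ()
  upFibreSum-formula zero zero ψ (suc (suc M)) ()
  upFibreSum-formula zero (suc r) ψ M ()
  upFibreSum-formula (suc L) zero ψ .(suc (suc L)) refl =
    cong₂ _+_ (upFibreSum-formula L zero (λ v → ψ (U ∷ v)) (suc L) refl
               ∙ Σw-cong (suc L) (λ v e → cong (_* ψ (U ∷ v)) (sym (upPreimages-noPeaks v L e))))
              (Σw-zero L (λ w _ → refl))
    ∙ cong (Σw (suc L) (λ v → upPreimages (U ∷ v) 0 * ψ (U ∷ v)) +_) (sym (Σw-zero (suc L) (λ v _ → refl)))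
  upFibreSum-formula (suc L) (suc r) ψ zero eq =
    cong₂ _+_ (upFibreSum-short L (suc r) (λ v → ψ (U ∷ v))
                 (s≤s (s≤s (≤-reflexive (suc-injective (suc-injective eq) ∙ +-identityʳ _)))))
              (fibreSum-formula L r ψ zero (suc-injective (suc-injective eq)))
  upFibreSum-formula (suc L) (suc r) ψ (suc M) eq =
    cong₂ _+_ (upFibreSum-formula L (suc r) (λ v → ψ (U ∷ v)) M (cong suc (eq′ ∙ +-suc (twice r) M)))
              (fibreSum-formula L r ψ (suc M) eq′)
    ∙ sym (+-assoc keepU peakUD startD)
    ∙ cong (_+ startD) (sym (Σw-distribʳ M (λ v → upPreimages v (suc r)) (λ v → preimages (U ∷ v) r) (λ v → ψ (U ∷ v)))
                        ∙ Σw-cong M (λ v _ → cong (_* ψ (U ∷ v)) (sym (preimages-U v r))))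
    where
    eq′ : L ≡ twice r + suc M
    eq′ = suc-injective (suc-injective eq)
    keepU peakUD startD : ℕ
    keepU = Σw M (λ v → upPreimages v (suc r) * ψ (U ∷ v))
    peakUD = Σw M (λ v → preimages (U ∷ v) r * ψ (U ∷ v))
    startD = Σw M (λ v → preimages (D ∷ v) r * ψ (D ∷ v))

ind-guard : ∀ b {x y : Bool} → (b ≡ true → x ≡ y) → ind (x ∧ b) ≡ ind b * ind y
ind-guard true {x} H = cong ind (∧-identityʳ x ∙ H refl) ∙ sym (+-identityʳ _)
ind-guard false {x} H = cong ind (∧-zeroʳ x)

isDyck≡excursionWith : ∀ m w → length w ≡ m + m → isDyck m w ≡ excursionWith 0 m w
isDyck≡excursionWith m w e =
  cong₂ _∧_ (sym (excursion≡endsAtZeroFrom 0 w))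
            (cong₂ _∧_ (≟⇒≡ᵇ (length w) (m + m) ∙ cong (_≡ᵇ (m + m)) e ∙ ≡ᵇ-refl (m + m)) (≟⇒≡ᵇ (countU w) m))

excursionWith-reduce : ∀ n r w → peaks w ≡ r → excursionWith 0 (n + r) w ≡ excursionWith 0 n (reduce w)
excursionWith-reduce n r w e =
  cong₂ _∧_ (sym (excursion-reduce 0 w))
            (cong (_≡ᵇ (n + r)) (sym (countU-reduce w) ∙ cong (countU (reduce w) +_) e) ∙ ≡ᵇ-cancelʳ (countU (reduce w)) n r)

countDyck-summand : ∀ n r s w → length w ≡ (n + r) + (n + r) →
  ind (isDyck (n + r) w ∧ (⌊ peaks w ℕ.≟ r ⌋ ∧ ⌊ plateaus w ℕ.≟ s ⌋)) ≡ ind (peaks w ≡ᵇ r) * weight 0 n s (reduce w)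
countDyck-summand n r s w e =
  cong ind (cong₂ _∧_ (isDyck≡excursionWith (n + r) w e)
                      (cong₂ _∧_ (≟⇒≡ᵇ (peaks w) r) (≟⇒≡ᵇ (plateaus w) s ∙ cong (_≡ᵇ s) (plateaus-reduce w)))
            ∙ rearrange (excursionWith 0 (n + r) w) (peaks w ≡ᵇ r) (peaks (reduce w) ≡ᵇ s))
  ∙ ind-guard (peaks w ≡ᵇ r) (λ e′ → cong (_∧ (peaks (reduce w) ≡ᵇ s)) (excursionWith-reduce n r w (≡ᵇ-sound _ _ e′)))
  where
  rearrange : ∀ x b c → x ∧ (b ∧ c) ≡ (x ∧ c) ∧ b
  rearrange x true c = cong (x ∧_) (sym (∧-identityʳ c)) ∙ sym (∧-assoc x c true)
  rearrange x false c = ∧-zeroʳ x ∙ sym (∧-zeroʳ (x ∧ c))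

paths-summand : ∀ n r w → weight 0 (n + r) r w ≡ ind (peaks w ≡ᵇ r) * ind (excursionWith 0 n (reduce w))
paths-summand n r w = ind-guard (peaks w ≡ᵇ r) (λ e → excursionWith-reduce n r w (≡ᵇ-sound _ _ e))

weight-peaks : ∀ h a k v (f g : ℕ) → (peaks v ≡ k → f ≡ g) → f * weight h a k v ≡ g * weight h a k v
weight-peaks h a k v f g H with peaks v ≡ᵇ k in e
... | true = cong (_* ind (excursionWith h a v ∧ true)) (H (≡ᵇ-sound _ _ e))
... | false rewrite ∧-zeroʳ (excursionWith h a v) = *-zeroʳ f ∙ sym (*-zeroʳ g)

length-split : ∀ n r → (n + r) + (n + r) ≡ twice r + (n + n)
length-split n r = regroup n r ∙ cong (_+ (n + n)) (sym (twice≡+ r))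
  where
  regroup : ∀ n r → (n + r) + (n + r) ≡ (r + r) + (n + n)
  regroup = solve-∀

fibre-narayana : ∀ a r k → suc k ≤ r →
  fibre (suc a + suc a) r (suc k) * paths (suc a + suc a) 0 (suc a) (suc k)
    ≡ narayana (suc a) (suc k) * ((suc a + suc a + r ∸ suc k) C (r ∸ suc k))
fibre-narayana a r k le =
  cong (fibre (suc a + suc a) r (suc k) *_) (paths-narayana a k)
  ∙ *-comm (fibre (suc a + suc a) r (suc k)) (narayana (suc a) (suc k))
  ∙ cong (narayana (suc a) (suc k) *_)
         (fibre-closed (suc a + suc a) r (suc k) le ∙ bin≡C (suc a + suc a + r ∸ suc k) (r ∸ suc k))

plateauCount : ∀ a r k → suc k ≤ r →
  countDyck (suc a + r) r (suc k) ≡ narayana (suc a) (suc k) * ((suc a + suc a + r ∸ suc k) C (r ∸ suc k))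
plateauCount a r k le =
  count-allWords L _
  ∙ Σw-cong L (λ w e → countDyck-summand n r s w e)
  ∙ fibreSum-formula L r (weight 0 n s) M (length-split n r)
  ∙ Σw-cong M (λ v e → weight-peaks 0 n s v (preimages v r) (fibre M r s) (λ e′ → cong₂ (λ x y → fibre x r y) e e′))
  ∙ Σw-* M (fibre M r s) (weight 0 n s)
  ∙ fibre-narayana a r k le
  where
  n s M L : ℕ
  n = suc a
  s = suc k
  M = n + n
  L = (n + r) + (n + r)

sumUpTo : ℕ → (ℕ → ℕ) → ℕ
sumUpTo zero g = g 0
sumUpTo (suc r) g = g 0 + sumUpTo r (λ p → g (suc p))

sumUpTo-cong : ∀ r {f g : ℕ → ℕ} → (∀ p → f p ≡ g p) → sumUpTo r f ≡ sumUpTo r g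
sumUpTo-cong zero H = H 0
sumUpTo-cong (suc r) H = cong₂ _+_ (H 0) (sumUpTo-cong r (λ p → H (suc p)))

sumUpTo-zero : ∀ r (g : ℕ → ℕ) → (∀ p → g p ≡ 0) → sumUpTo r g ≡ 0
sumUpTo-zero zero g H = H 0
sumUpTo-zero (suc r) g H = cong₂ _+_ (H 0) (sumUpTo-zero r _ (λ p → H (suc p)))

sumUpTo-*ʳ : ∀ r (g : ℕ → ℕ) k → sumUpTo r g * k ≡ sumUpTo r (λ p → g p * k)
sumUpTo-*ʳ zero g k = refl
sumUpTo-*ʳ (suc r) g k = *-distribʳ-+ k (g 0) _ ∙ cong (g 0 * k +_) (sumUpTo-*ʳ r (λ p → g (suc p)) k)

Σw-sumUpTo : ∀ M r (H : ℕ → List Step → ℕ) → Σw M (λ v → sumUpTo r (λ p → H p v)) ≡ sumUpTo r (λ p → Σw M (H p))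
Σw-sumUpTo M zero H = refl
Σw-sumUpTo M (suc r) H =
  Σw-+ M (H 0) (λ v → sumUpTo r (λ p → H (suc p) v)) ∙ cong (Σw M (H 0) +_) (Σw-sumUpTo M r (λ p → H (suc p)))

sumUpTo-select : ∀ r x (g : ℕ → ℕ) → (r < x → g x ≡ 0) → sumUpTo r (λ p → g p * ind (x ≡ᵇ p)) ≡ g x
sumUpTo-select zero zero g H = *-identityʳ (g 0)
sumUpTo-select zero (suc x) g H = *-zeroʳ (g 0) ∙ sym (H (s≤s z≤n))
sumUpTo-select (suc r) zero g H =
  cong₂ _+_ (*-identityʳ (g 0)) (sumUpTo-zero r _ (λ p → *-zeroʳ (g (suc p)))) ∙ +-identityʳ _
sumUpTo-select (suc r) (suc x) g H =
  cong (_+ sumUpTo r (λ p → g (suc p) * ind (x ≡ᵇ p))) (*-zeroʳ (g 0))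
  ∙ sumUpTo-select r x (λ p → g (suc p)) (λ lt → H (s≤s lt))

sumFrom1-shift : ∀ r (g : ℕ → ℕ) → sumFrom1 (suc r) g ≡ g 1 + sumFrom1 r (λ p → g (suc p))
sumFrom1-shift zero g = +-comm 0 (g 1)
sumFrom1-shift (suc r) g = cong (_+ g (suc (suc r))) (sumFrom1-shift r g) ∙ +-assoc (g 1) _ _

sumUpTo≡sumFrom1 : ∀ r (g : ℕ → ℕ) → sumUpTo r g ≡ g 0 + sumFrom1 r g
sumUpTo≡sumFrom1 zero g = sym (+-identityʳ _)
sumUpTo≡sumFrom1 (suc r) g = cong (g 0 +_) (sumUpTo≡sumFrom1 r (λ p → g (suc p)) ∙ sym (sumFrom1-shift r g))

sumFrom1-cong : ∀ r (f g : ℕ → ℕ) → (∀ s → 1 ≤ s → s ≤ r → f s ≡ g s) → sumFrom1 r f ≡ sumFrom1 r g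
sumFrom1-cong zero f g H = refl
sumFrom1-cong (suc r) f g H =
  cong₂ _+_ (sumFrom1-cong r f g (λ s a b → H s a (m≤n⇒m≤1+n b))) (H (suc r) (s≤s z≤n) ≤-refl)

fibre-beyond : ∀ M r p → r < p → fibre M r p ≡ 0
fibre-beyond M zero (suc p) lt = refl
fibre-beyond M (suc r) (suc p) (s≤s lt) = fibre-beyond M r p lt

preimages-byPeaks : ∀ M r n v → length v ≡ M →
  preimages v r * ind (excursionWith 0 n v) ≡ sumUpTo r (λ p → fibre M r p * weight 0 n p v)
preimages-byPeaks M r n v e =
  cong (λ t → fibre t r (peaks v) * ind (excursionWith 0 n v)) e
  ∙ cong (_* ind (excursionWith 0 n v)) (sym (sumUpTo-select r (peaks v) (fibre M r) (fibre-beyond M r (peaks v))))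
  ∙ sumUpTo-*ʳ r (λ p → fibre M r p * ind (peaks v ≡ᵇ p)) (ind (excursionWith 0 n v))
  ∙ sumUpTo-cong r (λ p → *-assoc (fibre M r p) _ _
      ∙ cong (fibre M r p *_) (*-comm (ind (peaks v ≡ᵇ p)) _ ∙ sym (ind-∧ (excursionWith 0 n v) (peaks v ≡ᵇ p))))

narayanaSum : ∀ a r′ → narayana (suc a + suc r′) (suc r′)
  ≡ sumFrom1 (suc r′) (λ s → narayana (suc a) s * ((suc a + suc a + suc r′ ∸ s) C (suc r′ ∸ s)))
narayanaSum a r′ =
  sym (paths-narayana (a + suc r′) r′)
  ∙ Σw-cong L (λ w _ → paths-summand n r w)
  ∙ fibreSum-formula L r (λ v → ind (excursionWith 0 n v)) M (length-split n r)
  ∙ Σw-cong M (λ v e → preimages-byPeaks M r n v e)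
  ∙ Σw-sumUpTo M r (λ p v → fibre M r p * weight 0 n p v)
  ∙ sumUpTo-cong r (λ p → Σw-* M (fibre M r p) (weight 0 n p))
  ∙ sumUpTo≡sumFrom1 r (λ p → fibre M r p * paths M 0 n p)
  ∙ cong (λ t → fibre M r 0 * t + sumFrom1 r (λ p → fibre M r p * paths M 0 n p)) (paths-noPeaks M 0 a)
  ∙ cong (_+ sumFrom1 r (λ p → fibre M r p * paths M 0 n p)) (*-zeroʳ (fibre M r 0))
  ∙ sumFrom1-cong r _ _ (λ { (suc k) (s≤s z≤n) le → fibre-narayana a r k le })
  where
  n r M L : ℕ
  n = suc a
  r = suc r′
  M = n + n
  L = (n + r) + (n + r)

mainTheorem1 : (n r : ℕ) → 1 ≤ n → 1 ≤ r →
    ((s : ℕ) → 1 ≤ s → s ≤ r →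
    countDyck (n + r) r s ≡ narayana n s * ((n + n + r ∸ s) C (r ∸ s)))
    × (narayana (n + r) r ≡ sumFrom1 r (λ s → narayana n s * ((n + n + r ∸ s) C (r ∸ s))))
mainTheorem1 (suc a) (suc r′) (s≤s z≤n) (s≤s z≤n) =
  (λ { (suc k) (s≤s z≤n) le → plateauCount a (suc r′) k le }) , narayanaSum a r′
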